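{- For all $n\ge 0$, $sm_n=2\,hm_n+1$, and \[hm_n=\frac{1}{2}\left(\sum_{j\ge 0}\binom{n}{j}\binom{n-j}{j}-1\right).\]
   Context: A Motzkin path of order $n$ is a lattice path from $(0,0)$ to $(n,0)$ with steps $U=(1,1)$, $D=(1,-1)$, $F=(1,0)$ never going below the $x$-axis. A super Motzkin path of order $n$ is a lattice path from $(0,0)$ to $(n,0)$ with these steps and no restriction on going below the $x$-axis. A hump in a path is a factor of consecutive steps of the form $UF^jD$ with $j\ge 0$. $sm_n$ is the number of super Motzkin paths of order $n$, and $hm_n$ is the total number of humps in all Motzkin paths of order $n$ (summed over all such paths). -}

module Defs where

open import Data.Nat using (ℕ; zero; suc; _+_; _*_; _∸_)
open import Data.Integer as ℤ using (ℤ; +_; -[1+_])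
open import Data.List using (List; []; _∷_; length; map; concatMap; filter; upTo)
open import Data.Nat.ListAction using (sum)
open import Data.Nat.Combinatorics using (_C_)
open import Data.Bool using (Bool; true; false; T; if_then_else_)
open import Relation.Nullary using (Dec; yes; no)
open import Relation.Nullary.Decidable using (does)

-- Steps U = (1,1), D = (1,-1), F = (1,0)
data Step : Set where
  U D F : Step

-- A lattice path starting at (0,0) is its list of steps; its order is its length.
Path : Set
Path = List Step

allPaths : ℕ → List Path
allPaths zero    = [] ∷ []
allPaths (suc n) = concatMap (λ p → (U ∷ p) ∷ (D ∷ p) ∷ (F ∷ p) ∷ []) (allPaths n)

δ : Step → ℤ
δ U = + 1
δ D = -[1+ 0 ]
δ F = + 0

endsAtZero : ℤ → Path → Bool
endsAtZero h []      = does (h ℤ.≟ + 0)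
endsAtZero h (s ∷ p) = endsAtZero (h ℤ.+ δ s) p

motzkinFrom : ℕ → Path → Bool
motzkinFrom zero    []      = true
motzkinFrom (suc _) []      = false
motzkinFrom h       (U ∷ p) = motzkinFrom (suc h) p
motzkinFrom h       (F ∷ p) = motzkinFrom h p
motzkinFrom zero    (D ∷ p) = false
motzkinFrom (suc h) (D ∷ p) = motzkinFrom h p

isSuperMotzkin : Path → Bool
isSuperMotzkin = endsAtZero (+ 0)

isMotzkin : Path → Bool
isMotzkin = motzkinFrom 0

superMotzkinPaths : ℕ → List Path
superMotzkinPaths n = filter (λ p → T? (isSuperMotzkin p)) (allPaths n)
  where
  T? : (b : Bool) → Dec (T b)
  T? true  = yes _
  T? false = no (λ ())

motzkinPaths : ℕ → List Path
motzkinPaths n = filter (λ p → T? (isMotzkin p)) (allPaths n)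
  where
  T? : (b : Bool) → Dec (T b)
  T? true  = yes _
  T? false = no (λ ())

closesHump : Path → Bool
closesHump []      = false
closesHump (F ∷ p) = closesHump p
closesHump (D ∷ _) = true
closesHump (U ∷ _) = false

-- number of humps (factors U F^j D, j ≥ 0) in a path: one per position
-- where a U step is immediately followed by F^j D
humps : Path → ℕ
humps []      = 0
humps (U ∷ p) = (if closesHump p then 1 else 0) + humps p
humps (D ∷ p) = humps p
humps (F ∷ p) = humps p

sm : ℕ → ℕ
sm n = length (superMotzkinPaths n)

hm : ℕ → ℕ
hm n = sum (map humps (motzkinPaths n))

-- Σ_{j ≥ 0} C(n,j) C(n-j,j); terms with j > n vanish, so j ranges over 0..n
binomSum : ℕ → ℕ
binomSum n = sum (map (λ j → (n C j) * ((n ∸ j) C j)) (upTo (suc n)))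

{-# OPTIONS --safe #-}
-- Let s(n,h) be the number of step sequences of length n that end at height 0 when started
-- at height h, m(n,h) the number of those that never go below the axis, and H(n,h) their total
-- number of humps, so that sm_n = s(n,0) and hm_n = H(n,0). Splitting off the first step shows
-- that H has the closed form H(n+2,h) = H(n+1,h) + (n+1) m(n,h). On the other side
-- s(n+2,0) = s(n+1,0) + 2 s(n+1,1) by the symmetry h ↦ −h, and s(n+1,1) = (n+1) m(n,0):
-- comparing coefficients in the derivative of (x + 1 + x⁻¹)^(n+1) gives
-- k s(n+1,k) = (n+1) (s(n,k−1) − s(n,k+1)), and the reflection principle gives
-- s(n,0) − s(n,2) = m(n,0). Hence sm_n = 2 hm_n + 1. Finally, counting the U and D steps,
-- s(n,k) = Σ_a C(n,a) C(n−a,a+k), which for k = 0 is the binomial sum.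

module Submission where

open import Defs
open import Data.Nat using (ℕ; _+_; _*_; _∸_; _/_)
open import Data.Product using (_×_)
open import Relation.Binary.PropositionalEquality using (_≡_)

open import Data.Bool using (Bool; true; false; T; if_then_else_)
open import Data.Bool.Properties using (if-eta)
open import Data.Empty using (⊥-elim)
open import Data.Integer as ℤ using (ℤ; +_; -[1+_])
import Data.Integer.Properties as ℤP
import Data.Integer.Tactic.RingSolver as ℤ-Solver
open import Data.List using (List; []; _∷_; length; map; concatMap; filter; applyUpTo)
open import Data.List.Properties using (map-cong)
open import Data.Nat using (zero; suc; pred; _<_; s≤s)
open import Data.Nat.Combinatorics using (_C_; nCk+nC[k+1]≡[n+1]C[k+1]; k>n⇒nCk≡0)
open import Data.Nat.DivMod using (m*n/n≡m)
open import Data.Nat.ListAction using (sum)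
open import Data.Nat.Properties
open import Data.Nat.Tactic.RingSolver using (solve-∀)
open import Data.Product using (_,_)
open import Data.Unit using (tt)
open import Function using (_∘_)
open import Relation.Nullary using (Dec; yes; no)
open import Relation.Nullary.Decidable using (does)
open import Relation.Binary.PropositionalEquality using (refl; sym; trans; cong; cong₂; module ≡-Reasoning)

open ≡-Reasoning

+-interchange : ∀ a b c d → a + b + (c + d) ≡ a + c + (b + d)
+-interchange = solve-∀

indicator : Bool → ℕ
indicator b = if b then 1 else 0

does-T : ∀ {b} (b? : Dec (T b)) → does b? ≡ b
does-T {true}  (yes _)  = refl
does-T {true}  (no ¬b)  = ⊥-elim (¬b tt)
does-T {false} (yes ())
does-T {false} (no _)   = refl

module _ {A : Set} where

  length-filter-T : (f : A → Bool) (P? : ∀ x → Dec (T (f x))) (xs : List A) →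
                    length (filter P? xs) ≡ sum (map (indicator ∘ f) xs)
  length-filter-T f P? []       = refl
  length-filter-T f P? (x ∷ xs) rewrite does-T (P? x) with f x
  ... | true  = cong suc (length-filter-T f P? xs)
  ... | false = length-filter-T f P? xs

  sum-map-filter-T : (f : A → Bool) (P? : ∀ x → Dec (T (f x))) (g : A → ℕ) (xs : List A) →
                     sum (map g (filter P? xs)) ≡ sum (map (λ x → if f x then g x else 0) xs)
  sum-map-filter-T f P? g []       = refl
  sum-map-filter-T f P? g (x ∷ xs) rewrite does-T (P? x) with f x
  ... | true  = cong (_+_ (g x)) (sum-map-filter-T f P? g xs)
  ... | false = sum-map-filter-T f P? g xs

  sum-map-+ : (v w : A → ℕ) (xs : List A) →
              sum (map (λ x → v x + w x) xs) ≡ sum (map v xs) + sum (map w xs)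
  sum-map-+ v w []       = refl
  sum-map-+ v w (x ∷ xs) = trans (cong (_+_ (v x + w x)) (sum-map-+ v w xs))
                                 (+-interchange (v x) (w x) (sum (map v xs)) (sum (map w xs)))

  sum-map-zero : ∀ {w : A → ℕ} → (∀ x → w x ≡ 0) → (xs : List A) → sum (map w xs) ≡ 0
  sum-map-zero w≡0 []       = refl
  sum-map-zero w≡0 (x ∷ xs) = cong₂ _+_ (w≡0 x) (sum-map-zero w≡0 xs)

pathSum : ℕ → (Path → ℕ) → ℕ
pathSum n w = sum (map w (allPaths n))

pathSum-cong : ∀ n {v w} → (∀ p → v p ≡ w p) → pathSum n v ≡ pathSum n w
pathSum-cong n v≗w = cong sum (map-cong v≗w (allPaths n))

pathSum-suc : ∀ n w → pathSum (suc n) w ≡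
              pathSum n (w ∘ (U ∷_)) + pathSum n (w ∘ (D ∷_)) + pathSum n (w ∘ (F ∷_))
pathSum-suc n w = extend (allPaths n)
  where
  Σ : (Path → ℕ) → List Path → ℕ
  Σ v ps = sum (map v ps)

  rearrange : ∀ a b c d e f → a + (b + (c + (d + e + f))) ≡ a + d + (b + e) + (c + f)
  rearrange = solve-∀

  extend : ∀ ps → Σ w (concatMap (λ p → (U ∷ p) ∷ (D ∷ p) ∷ (F ∷ p) ∷ []) ps) ≡
                  Σ (w ∘ (U ∷_)) ps + Σ (w ∘ (D ∷_)) ps + Σ (w ∘ (F ∷_)) ps
  extend []       = refl
  extend (p ∷ ps) = trans (cong (λ t → w (U ∷ p) + (w (D ∷ p) + (w (F ∷ p) + t))) (extend ps))
                          (rearrange (w (U ∷ p)) (w (D ∷ p)) (w (F ∷ p))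
                                     (Σ (w ∘ (U ∷_)) ps) (Σ (w ∘ (D ∷_)) ps) (Σ (w ∘ (F ∷_)) ps))

lag : (ℕ → ℕ) → ℕ → ℕ
lag f zero    = 0
lag f (suc h) = f h

lag-cong : ∀ {f g} → (∀ h → f h ≡ g h) → ∀ h → lag f h ≡ lag g h
lag-cong f≗g zero    = refl
lag-cong f≗g (suc h) = f≗g h

onMotzkin : ℕ → (Path → ℕ) → Path → ℕ
onMotzkin h w p = if motzkinFrom h p then w p else 0

onMotzkin-+ : ∀ h v w p → onMotzkin h (λ q → v q + w q) p ≡ onMotzkin h v p + onMotzkin h w p
onMotzkin-+ h v w p with motzkinFrom h p
... | true  = refl
... | false = refl

pathSum-onMotzkin-suc : ∀ n h w → pathSum (suc n) (onMotzkin h w) ≡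
                        pathSum n (onMotzkin (suc h) (w ∘ (U ∷_))) +
                        lag (λ h′ → pathSum n (onMotzkin h′ (w ∘ (D ∷_)))) h +
                        pathSum n (onMotzkin h (w ∘ (F ∷_)))
pathSum-onMotzkin-suc n h w =
  trans (pathSum-suc n (onMotzkin h w))
        (cong₂ _+_ (cong₂ _+_ (pathSum-cong n (up h)) (down h)) (pathSum-cong n (flat h)))
  where
  up : ∀ h p → onMotzkin h w (U ∷ p) ≡ onMotzkin (suc h) (w ∘ (U ∷_)) p
  up zero    p = refl
  up (suc h) p = refl

  flat : ∀ h p → onMotzkin h w (F ∷ p) ≡ onMotzkin h (w ∘ (F ∷_)) p
  flat zero    p = refl
  flat (suc h) p = refl

  down : ∀ h → pathSum n (onMotzkin h w ∘ (D ∷_)) ≡ lag (λ h′ → pathSum n (onMotzkin h′ (w ∘ (D ∷_)))) h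
  down zero    = sum-map-zero (λ _ → refl) (allPaths n)
  down (suc h) = refl

motzkinCount : ℕ → ℕ → ℕ
motzkinCount zero    zero    = 1
motzkinCount zero    (suc h) = 0
motzkinCount (suc n) h       = motzkinCount n (suc h) + lag (motzkinCount n) h + motzkinCount n h

pathSum-motzkinCount : ∀ n h → pathSum n (onMotzkin h (λ _ → 1)) ≡ motzkinCount n h
pathSum-motzkinCount zero    zero    = refl
pathSum-motzkinCount zero    (suc h) = refl
pathSum-motzkinCount (suc n) h       =
  trans (pathSum-onMotzkin-suc n h (λ _ → 1))
        (cong₂ _+_ (cong₂ _+_ (pathSum-motzkinCount n (suc h)) (lag-cong (pathSum-motzkinCount n) h))
                   (pathSum-motzkinCount n h))

motzkinCountSum : ℕ → ℕ → ℕ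
motzkinCountSum zero    h = 0
motzkinCountSum (suc n) h = motzkinCount n h + motzkinCountSum n h

pathSum-closesHump : ∀ n h → pathSum n (onMotzkin h (indicator ∘ closesHump)) ≡ lag (motzkinCountSum n) h
pathSum-closesHump zero    zero    = refl
pathSum-closesHump zero    (suc h) = refl
pathSum-closesHump (suc n) h       = begin
  pathSum (suc n) (onMotzkin h (indicator ∘ closesHump))
    ≡⟨ pathSum-onMotzkin-suc n h (indicator ∘ closesHump) ⟩
  pathSum n (onMotzkin (suc h) (λ _ → 0)) + lag (λ h′ → pathSum n (onMotzkin h′ (λ _ → 1))) h +
    pathSum n (onMotzkin h (indicator ∘ closesHump))
    ≡⟨ cong₂ _+_ (cong₂ _+_ (sum-map-zero (λ p → if-eta (motzkinFrom (suc h) p)) (allPaths n))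
                            (lag-cong (pathSum-motzkinCount n) h))
                 (pathSum-closesHump n h) ⟩
  lag (motzkinCount n) h + lag (motzkinCountSum n) h
    ≡⟨ lag-+ h ⟩
  lag (motzkinCountSum (suc n)) h ∎
  where
  lag-+ : ∀ h → lag (motzkinCount n) h + lag (motzkinCountSum n) h ≡ lag (motzkinCountSum (suc n)) h
  lag-+ zero    = refl
  lag-+ (suc h) = refl

humpTotal : ℕ → ℕ → ℕ
humpTotal zero          h = 0
humpTotal (suc zero)    h = 0
humpTotal (suc (suc n)) h = humpTotal (suc n) h + suc n * motzkinCount n h

humpTotal-suc : ∀ n h → humpTotal (suc n) h ≡
                motzkinCountSum n h + humpTotal n (suc h) + lag (humpTotal n) h + humpTotal n h
humpTotal-suc zero          zero    = refl
humpTotal-suc zero          (suc h) = refl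
humpTotal-suc (suc zero)    zero    = refl
humpTotal-suc (suc zero)    (suc h) = refl
humpTotal-suc (suc (suc n)) h       = begin
  humpTotal (suc (suc n)) h + suc (suc n) * motzkinCount (suc n) h
    ≡⟨ cong (_+ suc (suc n) * motzkinCount (suc n) h) (humpTotal-suc (suc n) h) ⟩
  c + g₊ + g₋ + g + suc (suc n) * (m₊ + m₋ + m)
    ≡⟨ rearrange c g₊ g₋ g m₊ m₋ m n ⟩
  (m₊ + m₋ + m + c) + (g₊ + suc n * m₊) + (g₋ + suc n * m₋) + (g + suc n * m)
    ≡⟨ cong (λ t → motzkinCountSum (suc (suc n)) h + humpTotal (suc (suc n)) (suc h) + t + humpTotal (suc (suc n)) h)
            (sym (lag-humpTotal h)) ⟩
  motzkinCountSum (suc (suc n)) h + humpTotal (suc (suc n)) (suc h) +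
    lag (humpTotal (suc (suc n))) h + humpTotal (suc (suc n)) h ∎
  where
  c  = motzkinCountSum (suc n) h
  g₊ = humpTotal (suc n) (suc h)
  g₋ = lag (humpTotal (suc n)) h
  g  = humpTotal (suc n) h
  m₊ = motzkinCount n (suc h)
  m₋ = lag (motzkinCount n) h
  m  = motzkinCount n h

  rearrange : ∀ c g₊ g₋ g m₊ m₋ m k →
              c + g₊ + g₋ + g + suc (suc k) * (m₊ + m₋ + m) ≡
              (m₊ + m₋ + m + c) + (g₊ + suc k * m₊) + (g₋ + suc k * m₋) + (g + suc k * m)
  rearrange = solve-∀

  lag-humpTotal : ∀ h → lag (humpTotal (suc (suc n))) h ≡ lag (humpTotal (suc n)) h + suc n * lag (motzkinCount n) h
  lag-humpTotal zero    = sym (*-zeroʳ (suc n))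
  lag-humpTotal (suc h) = refl

pathSum-humps : ∀ n h → pathSum n (onMotzkin h humps) ≡ humpTotal n h
pathSum-humps zero    zero    = refl
pathSum-humps zero    (suc h) = refl
pathSum-humps (suc n) h       = begin
  pathSum (suc n) (onMotzkin h humps)
    ≡⟨ pathSum-onMotzkin-suc n h humps ⟩
  pathSum n (onMotzkin (suc h) (λ p → indicator (closesHump p) + humps p)) +
    lag (λ h′ → pathSum n (onMotzkin h′ humps)) h + pathSum n (onMotzkin h humps)
    ≡⟨ cong (λ t → t + lag (λ h′ → pathSum n (onMotzkin h′ humps)) h + pathSum n (onMotzkin h humps))
            (trans (pathSum-cong n (onMotzkin-+ (suc h) (indicator ∘ closesHump) humps))
                   (sum-map-+ (onMotzkin (suc h) (indicator ∘ closesHump)) (onMotzkin (suc h) humps) (allPaths n))) ⟩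
  pathSum n (onMotzkin (suc h) (indicator ∘ closesHump)) + pathSum n (onMotzkin (suc h) humps) +
    lag (λ h′ → pathSum n (onMotzkin h′ humps)) h + pathSum n (onMotzkin h humps)
    ≡⟨ cong₂ _+_ (cong₂ _+_ (cong₂ _+_ (pathSum-closesHump n (suc h)) (pathSum-humps n (suc h)))
                            (lag-cong (pathSum-humps n) h))
                 (pathSum-humps n h) ⟩
  motzkinCountSum n h + humpTotal n (suc h) + lag (humpTotal n) h + humpTotal n h
    ≡⟨ sym (humpTotal-suc n h) ⟩
  humpTotal (suc n) h ∎

superCount : ℕ → ℤ → ℕ
superCount zero    h = indicator (does (h ℤ.≟ + 0))
superCount (suc n) h = superCount n (h ℤ.+ + 1) + superCount n (h ℤ.+ -[1+ 0 ]) + superCount n h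

pathSum-superCount : ∀ n h → pathSum n (indicator ∘ endsAtZero h) ≡ superCount n h
pathSum-superCount zero    h = +-identityʳ _
pathSum-superCount (suc n) h =
  trans (pathSum-suc n (indicator ∘ endsAtZero h))
        (cong₂ _+_ (cong₂ _+_ (pathSum-superCount n _) (pathSum-superCount n _))
                   (trans (pathSum-superCount n _) (cong (superCount n) (ℤP.+-identityʳ h))))

superCount-neg : ∀ n h → superCount n (ℤ.- h) ≡ superCount n h
superCount-neg zero    (+ zero)  = refl
superCount-neg zero    (+ suc m) = refl
superCount-neg zero    -[1+ m ]  = refl
superCount-neg (suc n) h         = begin
  superCount n (ℤ.- h ℤ.+ + 1) + superCount n (ℤ.- h ℤ.+ -[1+ 0 ]) + superCount n (ℤ.- h)
    ≡⟨ cong₂ _+_ (cong₂ _+_ (neg-step -[1+ 0 ]) (neg-step (+ 1))) (superCount-neg n h) ⟩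
  superCount n (h ℤ.+ -[1+ 0 ]) + superCount n (h ℤ.+ + 1) + superCount n h
    ≡⟨ cong (_+ superCount n h) (+-comm (superCount n (h ℤ.+ -[1+ 0 ])) _) ⟩
  superCount n (h ℤ.+ + 1) + superCount n (h ℤ.+ -[1+ 0 ]) + superCount n h ∎
  where
  neg-step : ∀ s → superCount n (ℤ.- h ℤ.+ ℤ.- s) ≡ superCount n (h ℤ.+ s)
  neg-step s = trans (cong (superCount n) (sym (ℤP.neg-distrib-+ h s))) (superCount-neg n (h ℤ.+ s))

-- Reflection principle: reflecting a path from height h that goes below the axis, up to its first
-- visit to height −1, yields a path from height −2 − h.
superCount-reflection : ∀ n h → superCount n (+ h) ≡ motzkinCount n h + superCount n (+ (2 + h))
superCount-reflection zero    zero    = refl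
superCount-reflection zero    (suc h) = refl
superCount-reflection (suc n) zero    = begin
  S 1 + superCount n -[1+ 0 ] + S 0
    ≡⟨ cong₂ _+_ (cong₂ _+_ (superCount-reflection n 1) (superCount-neg n (+ 1))) (superCount-reflection n 0) ⟩
  (M 1 + S 3) + S 1 + (M 0 + S 2)
    ≡⟨ rearrange (M 1) (S 3) (S 1) (M 0) (S 2) ⟩
  (M 1 + 0 + M 0) + (S 3 + S 1 + S 2) ∎
  where
  S M : ℕ → ℕ
  S k = superCount n (+ k)
  M   = motzkinCount n

  rearrange : ∀ a b c d e → (a + b) + c + (d + e) ≡ (a + 0 + d) + (b + c + e)
  rearrange = solve-∀
superCount-reflection (suc n) (suc h) = begin
  superCount n (+ suc h ℤ.+ + 1) + S h + S (1 + h)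
    ≡⟨ cong₂ _+_ (cong₂ _+_ (trans (step-up (1 + h)) (superCount-reflection n (2 + h))) (superCount-reflection n h))
                 (superCount-reflection n (1 + h)) ⟩
  (M (2 + h) + S (4 + h)) + (M h + S (2 + h)) + (M (1 + h) + S (3 + h))
    ≡⟨ rearrange (M (2 + h)) (S (4 + h)) (M h) (S (2 + h)) (M (1 + h)) (S (3 + h)) ⟩
  (M (2 + h) + M h + M (1 + h)) + (S (4 + h) + S (2 + h) + S (3 + h))
    ≡⟨ cong (λ t → motzkinCount (suc n) (suc h) + (t + S (2 + h) + S (3 + h))) (sym (step-up (3 + h))) ⟩
  motzkinCount (suc n) (suc h) + superCount (suc n) (+ (3 + h)) ∎
  where
  S M : ℕ → ℕ
  S k = superCount n (+ k)
  M   = motzkinCount n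

  step-up : ∀ k → superCount n (+ k ℤ.+ + 1) ≡ S (suc k)
  step-up k = cong S (+-comm k 1)

  rearrange : ∀ a b c d e f → (a + b) + (c + d) + (e + f) ≡ (a + c + e) + (b + d + f)
  rearrange = solve-∀

ballot-step : ∀ (c k a₊₊ a₊ a a₋ a₋₋ x₊ x₋ x : ℤ) →
              x₊ ≡ a₊₊ ℤ.+ a ℤ.+ a₊ → x₋ ≡ a ℤ.+ a₋₋ ℤ.+ a₋ →
              (k ℤ.+ + 1) ℤ.* x₊ ≡ c ℤ.* (a ℤ.- a₊₊) →
              (k ℤ.+ -[1+ 0 ]) ℤ.* x₋ ≡ c ℤ.* (a₋₋ ℤ.- a) →
              k ℤ.* x ≡ c ℤ.* (a₋ ℤ.- a₊) →
              k ℤ.* (x₊ ℤ.+ x₋ ℤ.+ x) ≡ (+ 1 ℤ.+ c) ℤ.* (x₋ ℤ.- x₊)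
ballot-step c k a₊₊ a₊ a a₋ a₋₋ _ _ x refl refl h₊ h₋ h = begin
  k ℤ.* ((a₊₊ ℤ.+ a ℤ.+ a₊) ℤ.+ (a ℤ.+ a₋₋ ℤ.+ a₋) ℤ.+ x)
    ≡⟨ ℤ-Solver.solve (k ∷ a₊₊ ∷ a₊ ∷ a ∷ a₋ ∷ a₋₋ ∷ x ∷ []) ⟩
  (k ℤ.+ + 1) ℤ.* (a₊₊ ℤ.+ a ℤ.+ a₊) ℤ.+ (k ℤ.+ -[1+ 0 ]) ℤ.* (a ℤ.+ a₋₋ ℤ.+ a₋) ℤ.+ k ℤ.* x
    ℤ.- (a₊₊ ℤ.+ a ℤ.+ a₊) ℤ.+ (a ℤ.+ a₋₋ ℤ.+ a₋)
    ≡⟨ cong (λ t → t ℤ.- (a₊₊ ℤ.+ a ℤ.+ a₊) ℤ.+ (a ℤ.+ a₋₋ ℤ.+ a₋)) (cong₂ ℤ._+_ (cong₂ ℤ._+_ h₊ h₋) h) ⟩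
  c ℤ.* (a ℤ.- a₊₊) ℤ.+ c ℤ.* (a₋₋ ℤ.- a) ℤ.+ c ℤ.* (a₋ ℤ.- a₊)
    ℤ.- (a₊₊ ℤ.+ a ℤ.+ a₊) ℤ.+ (a ℤ.+ a₋₋ ℤ.+ a₋)
    ≡⟨ ℤ-Solver.solve (c ∷ a₊₊ ∷ a₊ ∷ a ∷ a₋ ∷ a₋₋ ∷ []) ⟩
  (+ 1 ℤ.+ c) ℤ.* ((a ℤ.+ a₋₋ ℤ.+ a₋) ℤ.- (a₊₊ ℤ.+ a ℤ.+ a₊)) ∎

-- superCount n k is the coefficient of x^(−k) in (x + 1 + x⁻¹)^n; compare the coefficients of
-- x^(−k−1) in d/dx (x + 1 + x⁻¹)^(n+1) = (n+1) (1 − x⁻²) (x + 1 + x⁻¹)^n.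
superCount-ballot : ∀ n k → k ℤ.* + superCount (suc n) k ≡
                    + suc n ℤ.* (+ superCount n (k ℤ.+ -[1+ 0 ]) ℤ.- + superCount n (k ℤ.+ + 1))
superCount-ballot zero    (+ zero)          = refl
superCount-ballot zero    (+ suc zero)      = refl
superCount-ballot zero    (+ suc (suc m))   = ℤP.*-zeroʳ (+ suc (suc m))
superCount-ballot zero    -[1+ zero ]       = refl
superCount-ballot zero    -[1+ suc m ]      = ℤP.*-zeroʳ -[1+ suc m ]
superCount-ballot (suc n) k =
  ballot-step (+ suc n) k (s (k ℤ.+ + 1 ℤ.+ + 1)) (s (k ℤ.+ + 1)) (s k) (s (k ℤ.+ -[1+ 0 ]))
              (s (k ℤ.+ -[1+ 0 ] ℤ.+ -[1+ 0 ]))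
              (+ superCount (suc n) (k ℤ.+ + 1)) (+ superCount (suc n) (k ℤ.+ -[1+ 0 ])) (+ superCount (suc n) k)
              (cong (λ j → + (superCount n (k ℤ.+ + 1 ℤ.+ + 1) + superCount n j + superCount n (k ℤ.+ + 1))) +1-1)
              (cong (λ j → + (superCount n j + superCount n (k ℤ.+ -[1+ 0 ] ℤ.+ -[1+ 0 ]) + superCount n (k ℤ.+ -[1+ 0 ]))) -1+1)
              (trans (superCount-ballot n (k ℤ.+ + 1)) (cong (λ j → + suc n ℤ.* (s j ℤ.- s (k ℤ.+ + 1 ℤ.+ + 1))) +1-1))
              (trans (superCount-ballot n (k ℤ.+ -[1+ 0 ])) (cong (λ j → + suc n ℤ.* (s (k ℤ.+ -[1+ 0 ] ℤ.+ -[1+ 0 ]) ℤ.- s j)) -1+1))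
              (superCount-ballot n k)
  where
  s : ℤ → ℤ
  s j = + superCount n j

  +1-1 : k ℤ.+ + 1 ℤ.+ -[1+ 0 ] ≡ k
  +1-1 = trans (ℤP.+-assoc k (+ 1) -[1+ 0 ]) (ℤP.+-identityʳ k)

  -1+1 : k ℤ.+ -[1+ 0 ] ℤ.+ + 1 ≡ k
  -1+1 = trans (ℤP.+-assoc k -[1+ 0 ] (+ 1)) (ℤP.+-identityʳ k)

superCount-at-1 : ∀ n → superCount (suc n) (+ 1) ≡ suc n * motzkinCount n 0
superCount-at-1 n = ℤP.+-injective (begin
  + superCount (suc n) (+ 1)
    ≡⟨ sym (ℤP.*-identityˡ _) ⟩
  + 1 ℤ.* + superCount (suc n) (+ 1)
    ≡⟨ superCount-ballot n (+ 1) ⟩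
  + suc n ℤ.* (+ superCount n (+ 0) ℤ.- + superCount n (+ 2))
    ≡⟨ cong (λ t → + suc n ℤ.* (+ t ℤ.- + superCount n (+ 2))) (superCount-reflection n 0) ⟩
  + suc n ℤ.* (+ motzkinCount n 0 ℤ.+ + superCount n (+ 2) ℤ.- + superCount n (+ 2))
    ≡⟨ cong (+ suc n ℤ.*_) (cancel (+ motzkinCount n 0) (+ superCount n (+ 2))) ⟩
  + suc n ℤ.* + motzkinCount n 0
    ≡⟨ sym (ℤP.pos-* (suc n) (motzkinCount n 0)) ⟩
  + (suc n * motzkinCount n 0) ∎)
  where
  cancel : ∀ a b → a ℤ.+ b ℤ.- b ≡ a
  cancel = ℤ-Solver.solve-∀

superCount-at-0 : ∀ n → superCount n (+ 0) ≡ 2 * humpTotal n 0 + 1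
superCount-at-0 zero          = refl
superCount-at-0 (suc zero)    = refl
superCount-at-0 (suc (suc n)) = begin
  superCount (suc n) (+ 1) + superCount (suc n) -[1+ 0 ] + superCount (suc n) (+ 0)
    ≡⟨ cong₂ _+_ (cong₂ _+_ (superCount-at-1 n) (trans (superCount-neg (suc n) (+ 1)) (superCount-at-1 n)))
                 (superCount-at-0 (suc n)) ⟩
  suc n * motzkinCount n 0 + suc n * motzkinCount n 0 + (2 * humpTotal (suc n) 0 + 1)
    ≡⟨ rearrange (suc n * motzkinCount n 0) (humpTotal (suc n) 0) ⟩
  2 * (humpTotal (suc n) 0 + suc n * motzkinCount n 0) + 1 ∎
  where
  rearrange : ∀ m g → m + m + (2 * g + 1) ≡ 2 * (g + m) + 1
  rearrange = solve-∀

-- The number of step sequences of length n with a steps U and b steps D.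
trinomial : ℕ → ℕ → ℕ → ℕ
trinomial n a b = (n C a) * ((n ∸ a) C b)

trinomial-vanish : ∀ {n a} b → n < a → trinomial n a b ≡ 0
trinomial-vanish {n} {a} b n<a = cong (_* ((n ∸ a) C b)) (k>n⇒nCk≡0 n<a)

trinomial-suc : ∀ n a b → trinomial (suc n) a b ≡
                lag (λ a′ → trinomial n a′ b) a + lag (trinomial n a) b + trinomial n a b
trinomial-suc n zero    zero    = refl
trinomial-suc n zero    (suc b) = begin
  1 * (suc n C suc b)      ≡⟨ *-identityˡ _ ⟩
  suc n C suc b            ≡⟨ sym (nCk+nC[k+1]≡[n+1]C[k+1] n b) ⟩
  n C b + n C suc b        ≡⟨ sym (cong₂ _+_ (*-identityˡ (n C b)) (*-identityˡ (n C suc b))) ⟩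
  1 * (n C b) + 1 * (n C suc b) ∎
trinomial-suc n (suc a) zero    = begin
  (suc n C suc a) * 1      ≡⟨ cong (_* 1) (sym (nCk+nC[k+1]≡[n+1]C[k+1] n a)) ⟩
  (n C a + n C suc a) * 1  ≡⟨ *-distribʳ-+ 1 (n C a) (n C suc a) ⟩
  (n C a) * 1 + (n C suc a) * 1 ≡⟨ cong (_+ (n C suc a) * 1) (sym (+-identityʳ _)) ⟩
  (n C a) * 1 + 0 + (n C suc a) * 1 ∎
trinomial-suc n (suc a) (suc b) = begin
  (suc n C suc a) * ((n ∸ a) C suc b)
    ≡⟨ cong (_* ((n ∸ a) C suc b)) (sym (nCk+nC[k+1]≡[n+1]C[k+1] n a)) ⟩
  (n C a + n C suc a) * ((n ∸ a) C suc b)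
    ≡⟨ *-distribʳ-+ ((n ∸ a) C suc b) (n C a) (n C suc a) ⟩
  trinomial n a (suc b) + (n C suc a) * ((n ∸ a) C suc b)
    ≡⟨ cong (_+_ (trinomial n a (suc b))) pascal-∸ ⟩
  trinomial n a (suc b) + (n C suc a) * ((n ∸ suc a) C b + (n ∸ suc a) C suc b)
    ≡⟨ cong (_+_ (trinomial n a (suc b))) (*-distribˡ-+ (n C suc a) ((n ∸ suc a) C b) _) ⟩
  trinomial n a (suc b) + (trinomial n (suc a) b + trinomial n (suc a) (suc b))
    ≡⟨ sym (+-assoc (trinomial n a (suc b)) _ _) ⟩
  trinomial n a (suc b) + trinomial n (suc a) b + trinomial n (suc a) (suc b) ∎
  where
  pascal-∸ : (n C suc a) * ((n ∸ a) C suc b) ≡ (n C suc a) * ((n ∸ suc a) C b + (n ∸ suc a) C suc b)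
  pascal-∸ with n ∸ a in eq
  ... | zero  rewrite k>n⇒nCk≡0 {n} {suc a} (s≤s (m∸n≡0⇒m≤n eq)) = refl
  ... | suc r = cong ((n C suc a) *_) (trans (sym (nCk+nC[k+1]≡[n+1]C[k+1] r b))
                                             (cong (λ m → m C b + m C suc b) (sym n∸[1+a]≡r)))
    where
    n∸[1+a]≡r : n ∸ suc a ≡ r
    n∸[1+a]≡r = trans (sym (pred[m∸n]≡m∸[1+n] n a)) (cong pred eq)

trinomial-comm : ∀ n a b → trinomial n a b ≡ trinomial n b a
trinomial-comm zero    zero    zero    = refl
trinomial-comm zero    zero    (suc b) = refl
trinomial-comm zero    (suc a) zero    = refl
trinomial-comm zero    (suc a) (suc b) = refl
trinomial-comm (suc n) a       b       = begin
  trinomial (suc n) a b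
    ≡⟨ trinomial-suc n a b ⟩
  lag (λ a′ → trinomial n a′ b) a + lag (trinomial n a) b + trinomial n a b
    ≡⟨ cong₂ _+_ (cong₂ _+_ (lag-cong (λ a′ → trinomial-comm n a′ b) a) (lag-cong (trinomial-comm n a) b))
                 (trinomial-comm n a b) ⟩
  lag (trinomial n b) a + lag (λ b′ → trinomial n b′ a) b + trinomial n b a
    ≡⟨ cong (_+ trinomial n b a) (+-comm (lag (trinomial n b) a) _) ⟩
  lag (λ b′ → trinomial n b′ a) b + lag (trinomial n b) a + trinomial n b a
    ≡⟨ sym (trinomial-suc n b a) ⟩
  trinomial (suc n) b a ∎

sumBelow : ℕ → (ℕ → ℕ) → ℕ
sumBelow zero    f = 0
sumBelow (suc n) f = f 0 + sumBelow n (f ∘ suc)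

sumBelow-cong : ∀ n {f g} → (∀ i → f i ≡ g i) → sumBelow n f ≡ sumBelow n g
sumBelow-cong zero    f≗g = refl
sumBelow-cong (suc n) f≗g = cong₂ _+_ (f≗g 0) (sumBelow-cong n (f≗g ∘ suc))

sumBelow-+ : ∀ n f g → sumBelow n (λ i → f i + g i) ≡ sumBelow n f + sumBelow n g
sumBelow-+ zero    f g = refl
sumBelow-+ (suc n) f g = trans (cong (_+_ (f 0 + g 0)) (sumBelow-+ n (f ∘ suc) (g ∘ suc)))
                               (+-interchange (f 0) (g 0) (sumBelow n (f ∘ suc)) (sumBelow n (g ∘ suc)))

sumBelow-suc : ∀ n f → sumBelow (suc n) f ≡ sumBelow n f + f n
sumBelow-suc zero    f = +-identityʳ (f 0)
sumBelow-suc (suc n) f = trans (cong (_+_ (f 0)) (sumBelow-suc n (f ∘ suc))) (sym (+-assoc (f 0) _ _))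

sumBelow-suc-≡0 : ∀ n f → f n ≡ 0 → sumBelow (suc n) f ≡ sumBelow n f
sumBelow-suc-≡0 n f fn≡0 = trans (sumBelow-suc n f) (trans (cong (_+_ (sumBelow n f)) fn≡0) (+-identityʳ _))

sum-map-applyUpTo : ∀ n (g f : ℕ → ℕ) → sum (map f (applyUpTo g n)) ≡ sumBelow n (f ∘ g)
sum-map-applyUpTo zero    g f = refl
sum-map-applyUpTo (suc n) g f = cong (_+_ (f (g 0))) (sum-map-applyUpTo n (g ∘ suc) f)

centralSum : ℕ → ℕ → ℕ
centralSum n k = sumBelow (suc n) (λ a → trinomial n a (a + k))

downSum : ℕ → ℕ → ℕ
downSum n k = sumBelow (suc (suc n)) (λ a → lag (trinomial n a) (a + k))

centralSum-extend : ∀ n k → sumBelow (suc (suc n)) (λ a → trinomial n a (a + k)) ≡ centralSum n k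
centralSum-extend n k = sumBelow-suc-≡0 (suc n) (λ a → trinomial n a (a + k)) (trinomial-vanish (suc n + k) (n<1+n n))

downSum-zero : ∀ n → downSum n 0 ≡ centralSum n 1
downSum-zero n = sumBelow-cong (suc n) (λ a → trans (trinomial-comm n (suc a) (a + 0))
                                                    (cong₂ (trinomial n) (+-identityʳ a) (+-comm 1 a)))

downSum-suc : ∀ n k → downSum n (suc k) ≡ centralSum n k
downSum-suc n k = trans (sumBelow-cong (suc (suc n)) (λ a → cong (lag (trinomial n a)) (+-suc a k)))
                        (centralSum-extend n k)

centralSum-suc : ∀ n k → centralSum (suc n) k ≡ centralSum n (suc k) + downSum n k + centralSum n k
centralSum-suc n k = begin
  sumBelow (suc (suc n)) (λ a → trinomial (suc n) a (a + k))
    ≡⟨ sumBelow-cong (suc (suc n)) (λ a → trinomial-suc n a (a + k)) ⟩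
  sumBelow (suc (suc n)) (λ a → U-part a + D-part a + F-part a)
    ≡⟨ trans (sumBelow-+ (suc (suc n)) (λ a → U-part a + D-part a) F-part)
             (cong (_+ sumBelow (suc (suc n)) F-part) (sumBelow-+ (suc (suc n)) U-part D-part)) ⟩
  sumBelow (suc (suc n)) U-part + downSum n k + sumBelow (suc (suc n)) F-part
    ≡⟨ cong₂ (λ u v → u + downSum n k + v)
             (sumBelow-cong (suc n) (λ a → cong (trinomial n a) (sym (+-suc a k))))
             (centralSum-extend n k) ⟩
  centralSum n (suc k) + downSum n k + centralSum n k ∎
  where
  U-part D-part F-part : ℕ → ℕ
  U-part a = lag (λ a′ → trinomial n a′ (a + k)) a
  D-part a = lag (trinomial n a) (a + k)
  F-part a = trinomial n a (a + k)

superCount-centralSum : ∀ n k → superCount n (+ k) ≡ centralSum n k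
superCount-centralSum zero    zero    = refl
superCount-centralSum zero    (suc k) = refl
superCount-centralSum (suc n) zero    = begin
  superCount n (+ 1) + superCount n -[1+ 0 ] + superCount n (+ 0)
    ≡⟨ cong₂ _+_ (cong₂ _+_ (superCount-centralSum n 1)
                            (trans (superCount-neg n (+ 1)) (trans (superCount-centralSum n 1) (sym (downSum-zero n)))))
                 (superCount-centralSum n 0) ⟩
  centralSum n 1 + downSum n 0 + centralSum n 0
    ≡⟨ sym (centralSum-suc n 0) ⟩
  centralSum (suc n) 0 ∎
superCount-centralSum (suc n) (suc k) = begin
  superCount n (+ suc k ℤ.+ + 1) + superCount n (+ k) + superCount n (+ suc k)
    ≡⟨ cong₂ _+_ (cong₂ _+_ (trans (cong (λ t → superCount n (+ t)) (+-comm (suc k) 1)) (superCount-centralSum n (2 + k)))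
                            (trans (superCount-centralSum n k) (sym (downSum-suc n k))))
                 (superCount-centralSum n (suc k)) ⟩
  centralSum n (2 + k) + downSum n (suc k) + centralSum n (suc k)
    ≡⟨ sym (centralSum-suc n (suc k)) ⟩
  centralSum (suc n) (suc k) ∎

binomSum-centralSum : ∀ n → binomSum n ≡ centralSum n 0
binomSum-centralSum n =
  trans (sum-map-applyUpTo (suc n) (λ j → j) (λ j → trinomial n j j))
        (sumBelow-cong (suc n) (λ a → cong (trinomial n a) (sym (+-identityʳ a))))

sm-superCount : ∀ n → sm n ≡ superCount n (+ 0)
sm-superCount n = trans (length-filter-T isSuperMotzkin _ (allPaths n)) (pathSum-superCount n (+ 0))

hm-humpTotal : ∀ n → hm n ≡ humpTotal n 0
hm-humpTotal n = trans (sum-map-filter-T isMotzkin _ humps (allPaths n)) (pathSum-humps n 0)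

corollary2p1 : (n : ℕ) → (sm n ≡ 2 * hm n + 1) × (hm n ≡ (binomSum n ∸ 1) / 2)
corollary2p1 n = sm≡2hm+1 , hm≡binomSum
  where
  sm≡2hm+1 : sm n ≡ 2 * hm n + 1
  sm≡2hm+1 = begin
    sm n                    ≡⟨ sm-superCount n ⟩
    superCount n (+ 0)      ≡⟨ superCount-at-0 n ⟩
    2 * humpTotal n 0 + 1   ≡⟨ cong (λ g → 2 * g + 1) (hm-humpTotal n) ⟨
    2 * hm n + 1            ∎

  hm≡binomSum : hm n ≡ (binomSum n ∸ 1) / 2
  hm≡binomSum = begin
    hm n                    ≡⟨ m*n/n≡m (hm n) 2 ⟨
    hm n * 2 / 2            ≡⟨ cong (_/ 2) (*-comm (hm n) 2) ⟩
    2 * hm n / 2            ≡⟨ cong (_/ 2) (m+n∸n≡m (2 * hm n) 1) ⟨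
    (2 * hm n + 1 ∸ 1) / 2  ≡⟨ cong (λ t → (t ∸ 1) / 2) sm≡2hm+1 ⟨
    (sm n ∸ 1) / 2          ≡⟨ cong (λ t → (t ∸ 1) / 2) sm≡binomSum ⟩
    (binomSum n ∸ 1) / 2    ∎
    where
    sm≡binomSum : sm n ≡ binomSum n
    sm≡binomSum = trans (sm-superCount n)
                        (trans (superCount-centralSum n 0) (sym (binomSum-centralSum n)))
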